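{- Let $G$ be a graph, let $p \in \mathbb{N}$ and $N \in \mathbb{N}$. Suppose $P_{DP}(K_p \vee G, m) = P(K_p \vee G, m)$ for every integer $m \geq N$. Then $P_{DP}(K_{p+1} \vee G, s) = P(K_{p+1} \vee G, s)$ for every integer $s \geq N+1$. Consequently, $\tau_{DP}(K_{p+1} \vee G) \leq \tau_{DP}(K_p \vee G) + 1$.
   Context: All graphs are finite and simple. $G \vee H$ denotes the join of vertex-disjoint graphs $G$ and $H$. A cover of a graph $G$ is a pair $\mathcal{H}=(L,H)$ where $H$ is a graph and $L: V(G) \to \mathcal{P}(V(H))$ satisfies: (1) $\{L(u): u \in V(G)\}$ is a partition of $V(H)$ into $|V(G)|$ parts; (2) $H[L(u)]$ is complete for each $u$; (3) if there is an edge of $H$ between $L(u)$ and $L(v)$ with $u \neq v$, then $uv \in E(G)$; (4) if $uv \in E(G)$, the edges of $H$ between $L(u)$ and $L(v)$ form a (possibly empty) matching. The cover is $m$-fold if $|L(u)|=m$ for all $u$. An $\mathcal{H}$-coloring of $G$ is an independent set of $H$ of size $|V(G)|$. $P_{DP}(G,\mathcal{H})$ is the number of $\mathcal{H}$-colorings, and the DP color function $P_{DP}(G,m)$ is the minimum of $P_{DP}(G,\mathcal{H})$ over all $m$-fold covers $\mathcal{H}$ of $G$ ($m \in \mathbb{N}$). $P(G,m)$ is the chromatic polynomial (number of proper colorings of $G$ from $[m]$). The DP color function threshold $\tau_{DP}(G)$ is the smallest $N \geq \chi(G)$ such that $P_{DP}(G,m)=P(G,m)$ for all $m \geq N$, and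 $\tau_{DP}(G)=\infty$ if $P(G,m)-P_{DP}(G,m)>0$ for infinitely many $m$. -}

module Defs where

open import Data.Nat using (ℕ; zero; suc; _+_; _*_; _≤_; _<_)
open import Data.Bool using (Bool; true; false; _∧_; _∨_; not; if_then_else_)
open import Data.Fin using (Fin; zero; suc; _≟_; splitAt; combine; remQuot)
open import Data.Sum using (_⊎_; inj₁; inj₂)
open import Data.Product using (Σ; _×_; _,_; proj₁; proj₂)
open import Relation.Binary.PropositionalEquality using (_≡_; refl; sym)
open import Relation.Nullary using (yes; no)
open import Relation.Nullary.Decidable using (⌊_⌋)

record Graph : Set where
  field
    n      : ℕ
    adj    : Fin n → Fin n → Bool
    adj-sym    : ∀ u v → adj u v ≡ adj v u
    adj-irrefl : ∀ u → adj u u ≡ false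
open Graph public

eqF : ∀ {k} → Fin k → Fin k → Bool
eqF a b = ⌊ a ≟ b ⌋

eqF-sym : ∀ {k} (a b : Fin k) → eqF a b ≡ eqF b a
eqF-sym a b with a ≟ b | b ≟ a
... | yes _ | yes _ = refl
... | no _  | no _  = refl
... | yes refl | no ¬p = Data.Empty.⊥-elim (¬p refl)
  where import Data.Empty
... | no ¬p | yes refl = Data.Empty.⊥-elim (¬p refl)
  where import Data.Empty

eqF-refl : ∀ {k} (a : Fin k) → eqF a a ≡ true
eqF-refl a with a ≟ a
... | yes _ = refl
... | no ¬p = Data.Empty.⊥-elim (¬p refl)
  where import Data.Empty

K : ℕ → Graph
K p = record
  { n = p
  ; adj = λ a b → not (eqF a b)
  ; adj-sym = λ a b → helper a b
  ; adj-irrefl = λ a → helper2 a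
  }
  where
  helper : ∀ a b → not (eqF a b) ≡ not (eqF b a)
  helper a b rewrite eqF-sym a b = refl
  helper2 : ∀ a → not (eqF a a) ≡ false
  helper2 a rewrite eqF-refl a = refl

joinAdj : (G H : Graph) → (Fin (n G) ⊎ Fin (n H)) → (Fin (n G) ⊎ Fin (n H)) → Bool
joinAdj G H (inj₁ a) (inj₁ b) = adj G a b
joinAdj G H (inj₁ a) (inj₂ b) = true
joinAdj G H (inj₂ a) (inj₁ b) = true
joinAdj G H (inj₂ a) (inj₂ b) = adj H a b

joinAdj-sym : (G H : Graph) → ∀ x y → joinAdj G H x y ≡ joinAdj G H y x
joinAdj-sym G H (inj₁ a) (inj₁ b) = adj-sym G a b
joinAdj-sym G H (inj₁ a) (inj₂ b) = refl
joinAdj-sym G H (inj₂ a) (inj₁ b) = refl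
joinAdj-sym G H (inj₂ a) (inj₂ b) = adj-sym H a b

joinAdj-irrefl : (G H : Graph) → ∀ x → joinAdj G H x x ≡ false
joinAdj-irrefl G H (inj₁ a) = adj-irrefl G a
joinAdj-irrefl G H (inj₂ a) = adj-irrefl H a

_∨G_ : Graph → Graph → Graph
G ∨G H = record
  { n = n G + n H
  ; adj = λ u v → joinAdj G H (splitAt (n G) u) (splitAt (n G) v)
  ; adj-sym = λ u v → joinAdj-sym G H (splitAt (n G) u) (splitAt (n G) v)
  ; adj-irrefl = λ u → joinAdj-irrefl G H (splitAt (n G) u)
  }

allFin : (k : ℕ) → (Fin k → Bool) → Bool
allFin zero    f = true
allFin (suc k) f = f zero ∧ allFin k (λ i → f (suc i))

sumFin : (k : ℕ) → (Fin k → ℕ) → ℕ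
sumFin zero    f = 0
sumFin (suc k) f = f zero + sumFin k (λ i → f (suc i))

cons : ∀ {k} {A : Set} → A → (Fin k → A) → Fin (suc k) → A
cons a f zero    = a
cons a f (suc i) = f i

countFun : (k m : ℕ) → ((Fin k → Fin m) → Bool) → ℕ
countFun zero    m P = if P (λ ()) then 1 else 0
countFun (suc k) m P = sumFin m (λ a → countFun k m (λ c → P (cons a c)))

countSubsets : (k : ℕ) → ((Fin k → Bool) → Bool) → ℕ
countSubsets zero    P = if P (λ ()) then 1 else 0
countSubsets (suc k) P =
  countSubsets k (λ T → P (cons false T)) + countSubsets k (λ T → P (cons true T))

size : ∀ {k} → (Fin k → Bool) → ℕ
size {k} T = sumFin k (λ i → if T i then 1 else 0)

isProper : (G : Graph) (m : ℕ) → (Fin (n G) → Fin m) → Bool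
isProper G m c = allFin (n G) λ u → allFin (n G) λ v → not (adj G u v ∧ eqF (c u) (c v))

chromPoly : Graph → ℕ → ℕ
chromPoly G m = countFun (n G) m (isProper G m)

-- m-fold covers.  Up to isomorphism, V(H) = V(G) × [m] with
-- L(u) = {u} × Fin m.  Each L(u) is a clique; 'cross' gives the edges of H
-- between different parts.

record Cover (G : Graph) (m : ℕ) : Set where
  field
    cross     : Fin (n G) → Fin m → Fin (n G) → Fin m → Bool
    cross-sym : ∀ u i v j → cross u i v j ≡ cross v j u i
    cross-adj : ∀ u i v j → cross u i v j ≡ true → adj G u v ≡ true
    -- (4): edges between L(u) and L(v) form a matching
    --      (with symmetry, this gives injectivity on both sides)
    cross-matching : ∀ u i v j j' → cross u i v j ≡ true → cross u i v j' ≡ true → j ≡ j'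
open Cover public

coverEdge : {G : Graph} {m : ℕ} → Cover G m → (Fin (n G) × Fin m) → (Fin (n G) × Fin m) → Bool
coverEdge {G} {m} ℋ (u , i) (v , j) =
  if eqF u v then not (eqF i j) else cross ℋ u i v j

isIndependent : {G : Graph} {m : ℕ} → Cover G m → (Fin (n G * m) → Bool) → Bool
isIndependent {G} {m} ℋ T =
  allFin (n G * m) λ x → allFin (n G * m) λ y →
    not (T x ∧ T y ∧ coverEdge ℋ (remQuot m x) (remQuot m y))

dpCount : {G : Graph} {m : ℕ} → Cover G m → ℕ
dpCount {G} {m} ℋ = countSubsets (n G * m) λ T →
  isIndependent ℋ T ∧ eqN (size T) (n G)
  where
  open import Data.Nat using (_≡ᵇ_)
  eqN = _≡ᵇ_

IsDPColorValue : Graph → ℕ → ℕ → Set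
IsDPColorValue G m k = Σ (Cover G m) (λ ℋ → dpCount ℋ ≡ k) × (∀ (ℋ : Cover G m) → k ≤ dpCount ℋ)

DPEqChrom : Graph → ℕ → Set
DPEqChrom G m = IsDPColorValue G m (chromPoly G m)

Colorable : Graph → ℕ → Set
Colorable G k = Σ (Fin (n G) → Fin k) (λ c → isProper G k c ≡ true)

IsChromaticNumber : Graph → ℕ → Set
IsChromaticNumber G k = Colorable G k × (∀ j → j < k → Colorable G j → Data.Empty.⊥)
  where import Data.Empty

ThresholdOK : Graph → ℕ → Set
ThresholdOK G N = (∀ χ → IsChromaticNumber G χ → χ ≤ N) × (∀ m → N ≤ m → DPEqChrom G m)

IsDPThreshold : Graph → ℕ → Set
IsDPThreshold G N = ThresholdOK G N × (∀ N' → ThresholdOK G N' → N ≤ N')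

{-# OPTIONS --safe #-}
-- Let ℋ be an (m+1)-fold cover of K (suc p) ∨ G and a a colour of the apex.  As the apex is
-- adjacent to every other vertex, deleting (apex , a) together with its at most one neighbour
-- in each other fibre leaves an m-fold cover of K p ∨ G, and each of its colourings extends to
-- an ℋ-colouring giving the apex colour a.  Summing over a,
--   P_DP(K_{p+1} ∨ G, m+1) ≥ (m+1) P_DP(K_p ∨ G, m) = (m+1) P(K_p ∨ G, m) = P(K_{p+1} ∨ G, m+1),
-- and the canonical cover attains P.  The threshold bound then follows from
-- χ(K_{p+1} ∨ G) = χ(K_p ∨ G) + 1.
module Submission where

open import Defs
open import Data.Bool using (Bool; true; false; _∧_; _∨_; not; if_then_else_)
open import Data.Bool.Properties using (∧-assoc; ¬-not) renaming (_≟_ to _≟ᵇ_)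
open import Data.Empty using (⊥-elim)
open import Data.Fin using (Fin; zero; suc; _≟_; _↑ˡ_; _↑ʳ_; splitAt; remQuot; punchIn; punchOut)
open import Data.Fin.Properties
  using (suc-injective; punchIn-injective; punchInᵢ≢i; punchIn-punchOut; splitAt-↑ˡ; splitAt-↑ʳ; join-splitAt; any?)
open import Data.Nat using (ℕ; zero; suc; _≤_; _+_; _*_; z≤n; s≤s; _≡ᵇ_)
open import Data.Nat.Properties
  using (+-assoc; +-comm; +-identityʳ; +-mono-≤; +-monoʳ-≤; ≤-trans; ≤-reflexive; module ≤-Reasoning)
open import Data.Product using (_×_; ∃; _,_; proj₁; proj₂)
open import Data.Sum using (_⊎_; inj₁; inj₂)
open import Function using (_∘_)
open import Relation.Binary.PropositionalEquality
open import Relation.Nullary using (¬_; yes; no)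

∧-intro : ∀ {a b} → a ≡ true → b ≡ true → a ∧ b ≡ true
∧-intro refl refl = refl

∧-elimˡ : ∀ {a b} → a ∧ b ≡ true → a ≡ true
∧-elimˡ {true} _ = refl

∧-elimʳ : ∀ a {b} → a ∧ b ≡ true → b ≡ true
∧-elimʳ true h = h

∧-falseʳ : ∀ {a b} → (a ≡ true → b ≡ false) → a ∧ b ≡ false
∧-falseʳ {false} _ = refl
∧-falseʳ {true}  h = h refl

∧-falseˡ : ∀ {a} b → ¬ a ≡ true → a ∧ b ≡ false
∧-falseˡ {false} _ _ = refl
∧-falseˡ {true}  _ h = ⊥-elim (h refl)

∨-falseˡ : ∀ {a b} → a ∨ b ≡ false → a ≡ false
∨-falseˡ {false} _ = refl

∨-falseʳ : ∀ a {b} → a ∨ b ≡ false → b ≡ false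
∨-falseʳ false h = h

∨-false : ∀ {a b} → a ≡ false → b ≡ false → a ∨ b ≡ false
∨-false refl refl = refl

not-true⇒false : ∀ {b} → not b ≡ true → b ≡ false
not-true⇒false {false} _ = refl

false⇒not-true : ∀ {b} → b ≡ false → not b ≡ true
false⇒not-true refl = refl

true⇔true⇒≡ : ∀ {a b} → (a ≡ true → b ≡ true) → (b ≡ true → a ≡ true) → a ≡ b
true⇔true⇒≡ {true}  {true}  _ _ = refl
true⇔true⇒≡ {true}  {false} f _ = sym (f refl)
true⇔true⇒≡ {false} {true}  _ g = g refl
true⇔true⇒≡ {false} {false} _ _ = refl

nand-elim : ∀ {a b c} → not (a ∧ b ∧ c) ≡ true → a ≡ true → b ≡ true → c ≡ false
nand-elim {true} {true} {false} _ _ _ = refl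

nand-intro : ∀ a b c → (a ≡ true → b ≡ true → c ≡ false) → not (a ∧ b ∧ c) ≡ true
nand-intro false _    _ _ = refl
nand-intro true  false _ _ = refl
nand-intro true  true  c h rewrite h refl refl = refl

eqF-≡ : ∀ {k} {a b : Fin k} → eqF a b ≡ true → a ≡ b
eqF-≡ {a = a} {b} h with a ≟ b
... | yes a≡b = a≡b

eqF-≢ : ∀ {k} {a b : Fin k} → a ≢ b → eqF a b ≡ false
eqF-≢ {a = a} {b} a≢b with a ≟ b
... | yes a≡b = ⊥-elim (a≢b a≡b)
... | no _    = refl

not-eqF⇒≢ : ∀ {k} {a b : Fin k} → not (eqF a b) ≡ true → a ≢ b
not-eqF⇒≢ {a = a} h refl with () ← trans (sym h) (cong not (eqF-refl a))

eqF-injective : ∀ {k l} (f : Fin k → Fin l) → (∀ {a b} → f a ≡ f b → a ≡ b) →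
                ∀ a b → eqF (f a) (f b) ≡ eqF a b
eqF-injective f f-inj a b = true⇔true⇒≡
  (λ h → subst (λ z → eqF a z ≡ true) (f-inj (eqF-≡ h)) (eqF-refl a))
  (λ h → subst (λ z → eqF (f a) z ≡ true) (cong f (eqF-≡ h)) (eqF-refl (f a)))

eqF-suc : ∀ {k} (a b : Fin k) → eqF (Fin.suc a) (suc b) ≡ eqF a b
eqF-suc = eqF-injective suc suc-injective

eqF-punchIn : ∀ {k} (q : Fin (suc k)) (a b : Fin k) → eqF (punchIn q a) (punchIn q b) ≡ eqF a b
eqF-punchIn q = eqF-injective (punchIn q) (punchIn-injective q _ _)

AtMostOne : ∀ {m} → (Fin m → Bool) → Set
AtMostOne T = ∀ i j → T i ≡ true → T j ≡ true → i ≡ j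

AtMostOne-tail : ∀ {m} {T : Fin (suc m) → Bool} → AtMostOne T → AtMostOne (T ∘ suc)
AtMostOne-tail unique i j Ti Tj = suc-injective (unique (suc i) (suc j) Ti Tj)

AtMostOne⇒false-off-punchIn : ∀ {m} (f : Fin (suc m) → Bool) → AtMostOne f →
                              ∃ λ q → ∀ i → f (punchIn q i) ≡ false
AtMostOne⇒false-off-punchIn f unique with any? (λ j → f j ≟ᵇ true)
... | yes (q , fq) = q , λ i → ¬-not (λ fi → punchInᵢ≢i q i (unique _ _ fi fq))
... | no none      = zero , λ i → ¬-not (λ fi → none (_ , fi))

allFin-elim : ∀ k {f : Fin k → Bool} → allFin k f ≡ true → ∀ i → f i ≡ true
allFin-elim (suc k) h zero    = ∧-elimˡ h
allFin-elim (suc k) h (suc i) = allFin-elim k (∧-elimʳ _ h) i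

allFin-intro : ∀ k {f : Fin k → Bool} → (∀ i → f i ≡ true) → allFin k f ≡ true
allFin-intro zero    h = refl
allFin-intro (suc k) h = ∧-intro (h zero) (allFin-intro k (h ∘ suc))

allFin-cong : ∀ k {f g : Fin k → Bool} → f ≗ g → allFin k f ≡ allFin k g
allFin-cong zero    e = refl
allFin-cong (suc k) e = cong₂ _∧_ (e zero) (allFin-cong k (e ∘ suc))

sumFin-cong : ∀ k {f g : Fin k → ℕ} → f ≗ g → sumFin k f ≡ sumFin k g
sumFin-cong zero    e = refl
sumFin-cong (suc k) e = cong₂ _+_ (e zero) (sumFin-cong k (e ∘ suc))

sumFin-mono : ∀ k {f g : Fin k → ℕ} → (∀ i → f i ≤ g i) → sumFin k f ≤ sumFin k g
sumFin-mono zero    h = z≤n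
sumFin-mono (suc k) h = +-mono-≤ (h zero) (sumFin-mono k (h ∘ suc))

sumFin-≡0 : ∀ k {f : Fin k → ℕ} → (∀ i → f i ≡ 0) → sumFin k f ≡ 0
sumFin-≡0 zero    h = refl
sumFin-≡0 (suc k) h rewrite h zero = sumFin-≡0 k (h ∘ suc)

sumFin-punchIn : ∀ m (q : Fin (suc m)) (f : Fin (suc m) → ℕ) →
                 sumFin (suc m) f ≡ f q + sumFin m (f ∘ punchIn q)
sumFin-punchIn m       zero    f = refl
sumFin-punchIn (suc m) (suc q) f = begin
  f zero + sumFin (suc m) (f ∘ suc)   ≡⟨ cong (f zero +_) (sumFin-punchIn m q (f ∘ suc)) ⟩
  f zero + (f (suc q) + rest)         ≡⟨ sym (+-assoc (f zero) _ _) ⟩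
  f zero + f (suc q) + rest           ≡⟨ cong (_+ rest) (+-comm (f zero) _) ⟩
  f (suc q) + f zero + rest           ≡⟨ +-assoc (f (suc q)) _ _ ⟩
  f (suc q) + (f zero + rest)         ∎
  where
  open ≡-Reasoning
  rest : ℕ
  rest = sumFin m (f ∘ suc ∘ punchIn q)

sumFin-∘-injective : ∀ m s (φ : Fin m → Fin s) → (∀ {i j} → φ i ≡ φ j → i ≡ j) →
                     (g : Fin s → ℕ) → sumFin m (g ∘ φ) ≤ sumFin s g
sumFin-∘-injective zero    s       φ φ-inj g = z≤n
sumFin-∘-injective (suc m) zero    φ φ-inj g with φ zero
... | ()
sumFin-∘-injective (suc m) (suc s) φ φ-inj g = begin
  g (φ zero) + sumFin m (g ∘ φ ∘ suc)
    ≡⟨ cong (g (φ zero) +_) (sumFin-cong m λ i → cong g (sym (punchIn-punchOut (φ0≢ i)))) ⟩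
  g (φ zero) + sumFin m (g ∘ punchIn (φ zero) ∘ ψ)
    ≤⟨ +-monoʳ-≤ (g (φ zero)) (sumFin-∘-injective m s ψ ψ-inj (g ∘ punchIn (φ zero))) ⟩
  g (φ zero) + sumFin s (g ∘ punchIn (φ zero))
    ≡⟨ sym (sumFin-punchIn s (φ zero) g) ⟩
  sumFin (suc s) g
    ∎
  where
  open ≤-Reasoning
  φ0≢ : ∀ i → φ zero ≢ φ (suc i)
  φ0≢ i e with φ-inj e
  ... | ()
  ψ : Fin m → Fin s
  ψ i = punchOut (φ0≢ i)
  ψ-inj : ∀ {i j} → ψ i ≡ ψ j → i ≡ j
  ψ-inj {i} {j} e = suc-injective (φ-inj (trans (sym (punchIn-punchOut (φ0≢ i)))
                                           (trans (cong (punchIn (φ zero)) e) (punchIn-punchOut (φ0≢ j)))))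

Respects≗ : {A B C : Set} → ((A → B) → C) → Set
Respects≗ P = ∀ f g → f ≗ g → P f ≡ P g

Respects≗-cons : ∀ {k} {B C : Set} {P : (Fin (suc k) → B) → C} → Respects≗ P → ∀ b →
                 Respects≗ (λ f → P (cons b f))
Respects≗-cons resp b f g e = resp _ _ λ { zero → refl ; (suc u) → e u }

ifb : Bool → ℕ
ifb b = if b then 1 else 0

ifb-mono : ∀ {a b} → (a ≡ true → b ≡ true) → ifb a ≤ ifb b
ifb-mono {false} h = z≤n
ifb-mono {true}  h rewrite h refl = s≤s z≤n

countFun-cong : ∀ k m {P Q : (Fin k → Fin m) → Bool} → (∀ c → P c ≡ Q c) → countFun k m P ≡ countFun k m Q
countFun-cong zero    m e = cong ifb (e _)
countFun-cong (suc k) m e = sumFin-cong m λ a → countFun-cong k m (e ∘ cons a)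

countFun-≡0 : ∀ k m {P : (Fin k → Fin m) → Bool} → (∀ c → P c ≡ false) → countFun k m P ≡ 0
countFun-≡0 zero    m h = cong ifb (h _)
countFun-≡0 (suc k) m h = sumFin-≡0 m λ a → countFun-≡0 k m (h ∘ cons a)

avoids : ∀ {k m} → Fin m → (Fin k → Fin m) → Bool
avoids {k} a c = allFin k λ u → not (eqF (c u) a)

countFun-avoiding : ∀ k m (a : Fin (suc m)) {Q : (Fin k → Fin (suc m)) → Bool} → Respects≗ Q →
                    countFun k (suc m) (λ c → avoids a c ∧ Q c) ≡ countFun k m (λ d → Q (punchIn a ∘ d))
countFun-avoiding zero    m a resp = cong ifb (resp _ _ λ ())
countFun-avoiding (suc k) m a {Q} resp =
  trans (sumFin-punchIn m a λ b → countFun k (suc m) λ c → avoids a (cons b c) ∧ Q (cons b c))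
        (cong₂ _+_ (countFun-≡0 k (suc m) λ c → cong (λ z → (not z ∧ avoids a c) ∧ Q (cons a c)) (eqF-refl a))
                   (sumFin-cong m column))
  where
  open ≡-Reasoning
  column : ∀ b → countFun k (suc m) (λ c → (not (eqF (punchIn a b) a) ∧ avoids a c) ∧ Q (cons (punchIn a b) c))
               ≡ countFun k m (λ d → Q (punchIn a ∘ cons b d))
  column b = begin
    countFun k (suc m) (λ c → (not (eqF (punchIn a b) a) ∧ avoids a c) ∧ Q (cons (punchIn a b) c))
      ≡⟨ countFun-cong k (suc m) (λ c → cong (λ z → (not z ∧ avoids a c) ∧ Q (cons (punchIn a b) c))
                                             (eqF-≢ (punchInᵢ≢i a b))) ⟩
    countFun k (suc m) (λ c → avoids a c ∧ Q (cons (punchIn a b) c))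
      ≡⟨ countFun-avoiding k m a (Respects≗-cons resp (punchIn a b)) ⟩
    countFun k m (λ d → Q (cons (punchIn a b) (punchIn a ∘ d)))
      ≡⟨ countFun-cong k m (λ d → resp _ _ λ { zero → refl ; (suc u) → refl }) ⟩
    countFun k m (λ d → Q (punchIn a ∘ cons b d))
      ∎

countFun-≤-injective : ∀ k m s (φ : Fin k → Fin m → Fin s) → (∀ u {i j} → φ u i ≡ φ u j → i ≡ j) →
                       {P : (Fin k → Fin m) → Bool} {Q : (Fin k → Fin s) → Bool} → Respects≗ Q →
                       (∀ c → P c ≡ true → Q (λ u → φ u (c u)) ≡ true) → countFun k m P ≤ countFun k s Q
countFun-≤-injective zero    m s φ φ-inj resp P⇒Q = ifb-mono λ h → trans (resp _ _ λ ()) (P⇒Q _ h)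
countFun-≤-injective (suc k) m s φ φ-inj {P} {Q} resp P⇒Q =
  ≤-trans (sumFin-mono m column) (sumFin-∘-injective m s (φ zero) (φ-inj zero) λ b′ → countFun k s (Q ∘ cons b′))
  where
  column : ∀ b → countFun k m (P ∘ cons b) ≤ countFun k s (Q ∘ cons (φ zero b))
  column b = countFun-≤-injective k m s (φ ∘ suc) (φ-inj ∘ suc) (Respects≗-cons resp (φ zero b))
               λ c h → trans (resp _ _ λ { zero → refl ; (suc u) → refl }) (P⇒Q (cons b c) h)

countSubsets-cong : ∀ k {P Q : (Fin k → Bool) → Bool} → (∀ T → P T ≡ Q T) → countSubsets k P ≡ countSubsets k Q
countSubsets-cong zero    e = cong ifb (e _)
countSubsets-cong (suc k) e = cong₂ _+_ (countSubsets-cong k (e ∘ cons false)) (countSubsets-cong k (e ∘ cons true))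

countSubsets-≡0 : ∀ k {P : (Fin k → Bool) → Bool} → (∀ T → P T ≡ false) → countSubsets k P ≡ 0
countSubsets-≡0 zero    h = cong ifb (h _)
countSubsets-≡0 (suc k) h = cong₂ _+_ (countSubsets-≡0 k (h ∘ cons false)) (countSubsets-≡0 k (h ∘ cons true))

sumSubsets : (k : ℕ) → ((Fin k → Bool) → ℕ) → ℕ
sumSubsets zero    g = g (λ ())
sumSubsets (suc k) g = sumSubsets k (g ∘ cons false) + sumSubsets k (g ∘ cons true)

sumSubsets-≡0 : ∀ k {g : (Fin k → Bool) → ℕ} → (∀ T → g T ≡ 0) → sumSubsets k g ≡ 0
sumSubsets-≡0 zero    h = h _
sumSubsets-≡0 (suc k) h = cong₂ _+_ (sumSubsets-≡0 k (h ∘ cons false)) (sumSubsets-≡0 k (h ∘ cons true))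

append : ∀ {a b} → (Fin a → Bool) → (Fin b → Bool) → Fin (a + b) → Bool
append {zero}  S T = T
append {suc a} S T = cons (S zero) (append (S ∘ suc) T)

append-↑ˡ : ∀ {a b} (S : Fin a → Bool) (T : Fin b → Bool) i → append S T (i ↑ˡ b) ≡ S i
append-↑ˡ S T zero    = refl
append-↑ˡ S T (suc i) = append-↑ˡ (S ∘ suc) T i

append-↑ʳ : ∀ {a b} (S : Fin a → Bool) (T : Fin b → Bool) j → append S T (a ↑ʳ j) ≡ T j
append-↑ʳ {zero}  S T j = refl
append-↑ʳ {suc a} S T j = append-↑ʳ (S ∘ suc) T j

append-congˡ : ∀ {a b} {S S′ : Fin a → Bool} (T : Fin b → Bool) → S ≗ S′ → append S T ≗ append S′ T
append-congˡ {zero}  T e x       = refl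
append-congˡ {suc a} T e zero    = e zero
append-congˡ {suc a} T e (suc x) = append-congˡ T (e ∘ suc) x

append-split : ∀ a b (T : Fin (a + b) → Bool) → append (T ∘ (_↑ˡ b)) (T ∘ (a ↑ʳ_)) ≗ T
append-split zero    b T x       = refl
append-split (suc a) b T zero    = refl
append-split (suc a) b T (suc x) = append-split a b (T ∘ suc) x

countSubsets-append : ∀ a b (P : (Fin (a + b) → Bool) → Bool) →
                      countSubsets (a + b) P ≡ sumSubsets a (λ S → countSubsets b (λ T → P (append S T)))
countSubsets-append zero    b P = refl
countSubsets-append (suc a) b P =
  cong₂ _+_ (countSubsets-append a b (P ∘ cons false)) (countSubsets-append a b (P ∘ cons true))

size-cong : ∀ {k} {S T : Fin k → Bool} → S ≗ T → size S ≡ size T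
size-cong {k} e = sumFin-cong k (cong ifb ∘ e)

size-append : ∀ {a b} (S : Fin a → Bool) (T : Fin b → Bool) → size (append S T) ≡ size S + size T
size-append {zero}  S T = refl
size-append {suc a} S T = trans (cong (ifb (S zero) +_) (size-append (S ∘ suc) T))
                                (sym (+-assoc (ifb (S zero)) _ _))

AtMostOne⇒size≤1 : ∀ m {T : Fin m → Bool} → AtMostOne T → size T ≤ 1
AtMostOne⇒size≤1 zero    unique = z≤n
AtMostOne⇒size≤1 (suc m) {T} unique with T zero in T0
... | false = AtMostOne⇒size≤1 m (AtMostOne-tail unique)
... | true  = ≤-reflexive (cong suc (sumFin-≡0 m rest))
  where
  rest : ∀ i → ifb (T (suc i)) ≡ 0
  rest i with T (suc i) in Ti
  ... | false = refl
  ... | true with () ← unique zero (suc i) T0 Ti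

singleton : ∀ {m} → Fin m → Fin m → Bool
singleton zero    = cons true λ _ → false
singleton (suc a) = cons false (singleton a)

singleton-self : ∀ {m} (a : Fin m) → singleton a a ≡ true
singleton-self zero    = refl
singleton-self (suc a) = singleton-self a

singleton-≡ : ∀ {m} {a i : Fin m} → singleton a i ≡ true → i ≡ a
singleton-≡ {a = zero}  {zero}  _ = refl
singleton-≡ {a = suc a} {suc i} h = cong suc (singleton-≡ h)

size-singleton : ∀ {m} (a : Fin m) → size (singleton a) ≡ 1
size-singleton {suc m} zero    = cong suc (sumFin-≡0 m λ _ → refl)
size-singleton {suc m} (suc a) = size-singleton a

sumSubsets-onlyEmpty : ∀ m {g : (Fin m → Bool) → ℕ} → Respects≗ g → (∀ T i → T i ≡ true → g T ≡ 0) →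
                       sumSubsets m g ≡ g (λ _ → false)
sumSubsets-onlyEmpty zero    resp nonempty = resp _ _ λ ()
sumSubsets-onlyEmpty (suc m) resp nonempty =
  trans (cong₂ _+_ (sumSubsets-onlyEmpty m (Respects≗-cons resp false) (λ T i → nonempty _ (suc i)))
                   (sumSubsets-≡0 m λ T → nonempty _ zero refl))
        (trans (+-identityʳ _) (resp _ _ λ { zero → refl ; (suc u) → refl }))

sumSubsets-onlySingletons : ∀ m {g : (Fin m → Bool) → ℕ} → Respects≗ g →
  (∀ T i j → i ≢ j → T i ≡ true → T j ≡ true → g T ≡ 0) → (∀ T → (∀ i → T i ≡ false) → g T ≡ 0) →
  sumSubsets m g ≡ sumFin m (g ∘ singleton)
sumSubsets-onlySingletons zero    resp two empty = empty _ λ ()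
sumSubsets-onlySingletons (suc m) {g} resp two empty =
  trans (cong₂ _+_
           (sumSubsets-onlySingletons m (Respects≗-cons resp false)
              (λ T i j i≢j → two _ (suc i) (suc j) (i≢j ∘ suc-injective))
              (λ T none → empty _ λ { zero → refl ; (suc i) → none i }))
           (sumSubsets-onlyEmpty m (Respects≗-cons resp true) (λ T i → two _ zero (suc i) (λ ()) refl)))
        (+-comm (sumFin m (g ∘ singleton ∘ suc)) _)

Rel : ℕ → ℕ → Set
Rel n m = Fin n × Fin m → Fin n × Fin m → Bool

FibresAreCliques : ∀ {n m} → Rel n m → Set
FibresAreCliques R = ∀ u i j → i ≢ j → R (u , i) (u , j) ≡ true

independent : ∀ {n m} → Rel n m → (Fin (n * m) → Bool) → Bool
independent {n} {m} R T =
  allFin (n * m) λ x → allFin (n * m) λ y → not (T x ∧ T y ∧ R (remQuot {n} m x) (remQuot {n} m y))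

independentTransversal : ∀ {n m} → Rel n m → (Fin n → Fin m) → Bool
independentTransversal {n} R c = allFin n λ u → allFin n λ v → not (R (u , c u) (v , c v))

independent-elim : ∀ {n m} (R : Rel n m) {T} → independent R T ≡ true →
                   ∀ x y → T x ≡ true → T y ≡ true → R (remQuot {n} m x) (remQuot {n} m y) ≡ false
independent-elim {n} {m} R h x y = nand-elim (allFin-elim (n * m) (allFin-elim (n * m) h x) y)

independent-intro : ∀ {n m} (R : Rel n m) {T} →
                    (∀ x y → T x ≡ true → T y ≡ true → R (remQuot {n} m x) (remQuot {n} m y) ≡ false) →
                    independent R T ≡ true
independent-intro {n} {m} R h = allFin-intro (n * m) λ x → allFin-intro (n * m) λ y → nand-intro _ _ _ (h x y)

independent-resp : ∀ {n m} (R : Rel n m) → Respects≗ (independent R)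
independent-resp {n} {m} R T T′ e = allFin-cong (n * m) λ x → allFin-cong (n * m) λ y →
  cong₂ (λ p q → not (p ∧ q ∧ R (remQuot {n} m x) (remQuot {n} m y))) (e x) (e y)

independentTransversal-elim : ∀ {n m} (R : Rel n m) {c} → independentTransversal R c ≡ true →
                              ∀ u v → R (u , c u) (v , c v) ≡ false
independentTransversal-elim {n} R h u v = not-true⇒false (allFin-elim n (allFin-elim n h u) v)

independentTransversal-intro : ∀ {n m} (R : Rel n m) {c} → (∀ u v → R (u , c u) (v , c v) ≡ false) →
                               independentTransversal R c ≡ true
independentTransversal-intro {n} R h = allFin-intro n λ u → allFin-intro n λ v → false⇒not-true (h u v)

independentTransversal-resp : ∀ {n m} (R : Rel n m) → Respects≗ (independentTransversal R)
independentTransversal-resp {n} R c c′ e = allFin-cong n λ u → allFin-cong n λ v →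
  cong₂ (λ x y → not (R (u , x) (v , y))) (e u) (e v)

shift : ∀ {n m} → Fin n × Fin m → Fin (suc n) × Fin m
shift (u , i) = suc u , i

tailRel : ∀ {n m} → Rel (suc n) m → Rel n m
tailRel R p q = R (shift p) (shift q)

FibresAreCliques-tail : ∀ {n m} {R : Rel (suc n) m} → FibresAreCliques R → FibresAreCliques (tailRel R)
FibresAreCliques-tail cliques u = cliques (suc u)

remQuot-↑ˡ : ∀ n m (i : Fin m) → remQuot {suc n} m (i ↑ˡ (n * m)) ≡ (zero , i)
remQuot-↑ˡ n m i rewrite splitAt-↑ˡ m i (n * m) = refl

remQuot-↑ʳ : ∀ n m (y : Fin (n * m)) → remQuot {suc n} m (m ↑ʳ y) ≡ shift (remQuot {n} m y)
remQuot-↑ʳ n m y rewrite splitAt-↑ʳ m (n * m) y = refl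

↑ˡ⊎↑ʳ : ∀ a b (x : Fin (a + b)) → (∃ λ i → i ↑ˡ b ≡ x) ⊎ (∃ λ j → a ↑ʳ j ≡ x)
↑ˡ⊎↑ʳ a b x with splitAt a x | join-splitAt a b x
... | inj₁ i | e = inj₁ (i , e)
... | inj₂ j | e = inj₂ (j , e)

module _ {n m} (R : Rel (suc n) m) (S : Fin m → Bool) (T : Fin (n * m) → Bool) where

  IndependentParts : Set
  IndependentParts =
      (∀ i j → S i ≡ true → S j ≡ true → R (zero , i) (zero , j) ≡ false)
    × (∀ i y → S i ≡ true → T y ≡ true → R (zero , i) (shift (remQuot {n} m y)) ≡ false)
    × (∀ x j → T x ≡ true → S j ≡ true → R (shift (remQuot {n} m x)) (zero , j) ≡ false)
    × independent (tailRel R) T ≡ true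

  independent-append⇒parts : independent R (append S T) ≡ true → IndependentParts
  independent-append⇒parts h =
      (λ i j Si Sj → subst₂ edge (remQuot-↑ˡ n m i) (remQuot-↑ˡ n m j) (H (i ↑ˡ _) (j ↑ˡ _) (inS Si) (inS Sj)))
    , (λ i y Si Ty → subst₂ edge (remQuot-↑ˡ n m i) (remQuot-↑ʳ n m y) (H (i ↑ˡ _) (m ↑ʳ y) (inS Si) (inT Ty)))
    , (λ x j Tx Sj → subst₂ edge (remQuot-↑ʳ n m x) (remQuot-↑ˡ n m j) (H (m ↑ʳ x) (j ↑ˡ _) (inT Tx) (inS Sj)))
    , independent-intro (tailRel R)
        (λ x y Tx Ty → subst₂ edge (remQuot-↑ʳ n m x) (remQuot-↑ʳ n m y) (H (m ↑ʳ x) (m ↑ʳ y) (inT Tx) (inT Ty)))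
    where
    edge : Fin (suc n) × Fin m → Fin (suc n) × Fin m → Set
    edge p q = R p q ≡ false
    H = independent-elim R {append S T} h
    inS : ∀ {i} → S i ≡ true → append S T (i ↑ˡ (n * m)) ≡ true
    inS = trans (append-↑ˡ S T _)
    inT : ∀ {y} → T y ≡ true → append S T (m ↑ʳ y) ≡ true
    inT = trans (append-↑ʳ S T _)

  parts⇒independent-append : IndependentParts → independent R (append S T) ≡ true
  parts⇒independent-append (SS , ST , TS , TT) = independent-intro R go
    where
    fromS : ∀ {i} → append S T (i ↑ˡ (n * m)) ≡ true → S i ≡ true
    fromS = trans (sym (append-↑ˡ S T _))
    fromT : ∀ {y} → append S T (m ↑ʳ y) ≡ true → T y ≡ true
    fromT = trans (sym (append-↑ʳ S T _))
    go : ∀ x y → append S T x ≡ true → append S T y ≡ true →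
         R (remQuot {suc n} m x) (remQuot {suc n} m y) ≡ false
    go x y Tx Ty with ↑ˡ⊎↑ʳ m (n * m) x | ↑ˡ⊎↑ʳ m (n * m) y
    ... | inj₁ (i , refl) | inj₁ (j , refl) rewrite remQuot-↑ˡ n m i | remQuot-↑ˡ n m j = SS i j (fromS Tx) (fromS Ty)
    ... | inj₁ (i , refl) | inj₂ (j , refl) rewrite remQuot-↑ˡ n m i | remQuot-↑ʳ n m j = ST i j (fromS Tx) (fromT Ty)
    ... | inj₂ (i , refl) | inj₁ (j , refl) rewrite remQuot-↑ʳ n m i | remQuot-↑ˡ n m j = TS i j (fromT Tx) (fromS Ty)
    ... | inj₂ (i , refl) | inj₂ (j , refl) rewrite remQuot-↑ʳ n m i | remQuot-↑ʳ n m j =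
      independent-elim (tailRel R) TT i j (fromT Tx) (fromT Ty)

independent-head-AtMostOne : ∀ {n m} (R : Rel (suc n) m) → FibresAreCliques R → ∀ {S T} →
                             independent R (append S T) ≡ true → AtMostOne S
independent-head-AtMostOne R cliques {S} {T} h i j Si Sj with i ≟ j
... | yes i≡j = i≡j
... | no  i≢j with () ← trans (sym (cliques zero i j i≢j)) (proj₁ (independent-append⇒parts R S T h) i j Si Sj)

independent-size≤ : ∀ n m (R : Rel n m) → FibresAreCliques R → ∀ T → independent R T ≡ true → size T ≤ n
independent-size≤ zero    m R cliques T h = z≤n
independent-size≤ (suc n) m R cliques T h = begin
  size T                 ≡⟨ size-cong {S = append S T′} (append-split m (n * m) T) ⟨
  size (append S T′)     ≡⟨ size-append S T′ ⟩
  size S + size T′       ≤⟨ +-mono-≤ (AtMostOne⇒size≤1 m (independent-head-AtMostOne R cliques h′))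
                                      (independent-size≤ n m (tailRel R) (FibresAreCliques-tail {R = R} cliques) T′
                                         (proj₂ (proj₂ (proj₂ (independent-append⇒parts R S T′ h′))))) ⟩
  1 + n                  ∎
  where
  open ≤-Reasoning
  S  = T ∘ (_↑ˡ (n * m))
  T′ = T ∘ (m ↑ʳ_)
  h′ : independent R (append S T′) ≡ true
  h′ = trans (independent-resp R _ _ (append-split m (n * m) T)) h

adjacentTo : ∀ {n m} → Rel (suc n) m → Fin m → Fin n × Fin m → Bool
adjacentTo R a p = R (zero , a) (shift p) ∨ R (shift p) (zero , a)

NotAdjacentTo : ∀ {n m} → Rel (suc n) m → Fin m → Fin n × Fin m → Set
NotAdjacentTo R a p = R (zero , a) (shift p) ≡ false × R (shift p) (zero , a) ≡ false

-- Every vertex adjacent to (zero , a) becomes a loop, so that independence in the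
-- tail also keeps away from (zero , a).
avoidingRel : ∀ {n m} → Rel (suc n) m → Fin m → Rel n m
avoidingRel R a p q = tailRel R p q ∨ adjacentTo R a p ∨ adjacentTo R a q

module _ {n m} (R : Rel (suc n) m) (a : Fin m) where

  headLoopFree : Bool
  headLoopFree = not (R (zero , a) (zero , a))

  avoidingRel-tail : ∀ {p q} → avoidingRel R a p q ≡ false → tailRel R p q ≡ false
  avoidingRel-tail = ∨-falseˡ

  avoidingRel-loop : ∀ {p} → avoidingRel R a p p ≡ false → NotAdjacentTo R a p
  avoidingRel-loop {p} h = ∨-falseˡ adjacent , ∨-falseʳ (R (zero , a) (shift p)) adjacent
    where adjacent = ∨-falseˡ (∨-falseʳ (tailRel R p p) h)

  avoidingRel-false : ∀ {p q} → tailRel R p q ≡ false → NotAdjacentTo R a p → NotAdjacentTo R a q →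
                      avoidingRel R a p q ≡ false
  avoidingRel-false tail (p₁ , p₂) (q₁ , q₂) = ∨-false tail (∨-false (∨-false p₁ p₂) (∨-false q₁ q₂))

  FibresAreCliques-avoiding : FibresAreCliques R → FibresAreCliques (avoidingRel R a)
  FibresAreCliques-avoiding cliques u i j i≢j rewrite cliques (suc u) i j i≢j = refl

  independent-singleton-append : ∀ T → independent R (append (singleton a) T)
                                       ≡ headLoopFree ∧ independent (avoidingRel R a) T
  independent-singleton-append T = true⇔true⇒≡ split join
    where
    split : independent R (append (singleton a) T) ≡ true → headLoopFree ∧ independent (avoidingRel R a) T ≡ true
    split h with independent-append⇒parts R (singleton a) T h
    ... | SS , ST , TS , TT = ∧-intro (false⇒not-true (SS a a (singleton-self a) (singleton-self a)))
      (independent-intro (avoidingRel R a) λ x y Tx Ty →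
        avoidingRel-false (independent-elim (tailRel R) TT x y Tx Ty) (notAdj x Tx) (notAdj y Ty))
      where
      notAdj : ∀ x → T x ≡ true → NotAdjacentTo R a (remQuot m x)
      notAdj x Tx = ST a x (singleton-self a) Tx , TS x a Tx (singleton-self a)
    join : headLoopFree ∧ independent (avoidingRel R a) T ≡ true → independent R (append (singleton a) T) ≡ true
    join h = parts⇒independent-append R (singleton a) T
        ( (λ { i j Si Sj → subst₂ (λ i j → R (zero , i) (zero , j) ≡ false)
                                  (sym (singleton-≡ Si)) (sym (singleton-≡ Sj)) headLoop })
        , (λ i y Si Ty → subst (λ i → R (zero , i) _ ≡ false) (sym (singleton-≡ Si)) (proj₁ (notAdj y Ty)))
        , (λ x j Tx Sj → subst (λ j → R _ (zero , j) ≡ false) (sym (singleton-≡ Sj)) (proj₂ (notAdj x Tx)))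
        , independent-intro (tailRel R) λ x y Tx Ty → avoidingRel-tail (H x y Tx Ty))
      where
      headLoop : R (zero , a) (zero , a) ≡ false
      headLoop = not-true⇒false (∧-elimˡ h)
      H = independent-elim (avoidingRel R a) (∧-elimʳ headLoopFree h)
      notAdj : ∀ x → T x ≡ true → NotAdjacentTo R a (remQuot m x)
      notAdj x Tx = avoidingRel-loop (H x x Tx Tx)

  independentTransversal-cons : ∀ c → independentTransversal R (cons a c)
                                      ≡ headLoopFree ∧ independentTransversal (avoidingRel R a) c
  independentTransversal-cons c = true⇔true⇒≡ split join
    where
    split : independentTransversal R (cons a c) ≡ true →
            headLoopFree ∧ independentTransversal (avoidingRel R a) c ≡ true
    split h = ∧-intro (false⇒not-true (H zero zero))
      (independentTransversal-intro (avoidingRel R a) λ u v →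
        avoidingRel-false (H (suc u) (suc v)) (H zero (suc u) , H (suc u) zero) (H zero (suc v) , H (suc v) zero))
      where H = independentTransversal-elim R {cons a c} h
    join : headLoopFree ∧ independentTransversal (avoidingRel R a) c ≡ true →
           independentTransversal R (cons a c) ≡ true
    join h = independentTransversal-intro R go
      where
      H = independentTransversal-elim (avoidingRel R a) (∧-elimʳ headLoopFree h)
      go : ∀ u v → R (u , cons a c u) (v , cons a c v) ≡ false
      go zero    zero    = not-true⇒false (∧-elimˡ h)
      go zero    (suc v) = proj₁ (avoidingRel-loop (H v v))
      go (suc u) zero    = proj₂ (avoidingRel-loop (H u u))
      go (suc u) (suc v) = avoidingRel-tail (H u v)

≤⇒≡ᵇ-suc-false : ∀ {a n} → a ≤ n → (a ≡ᵇ suc n) ≡ false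
≤⇒≡ᵇ-suc-false {n = zero}  z≤n     = refl
≤⇒≡ᵇ-suc-false {n = suc n} z≤n     = refl
≤⇒≡ᵇ-suc-false             (s≤s p) = ≤⇒≡ᵇ-suc-false p

independentOfSize : ∀ {n m} → Rel n m → (Fin (n * m) → Bool) → Bool
independentOfSize {n} R T = independent R T ∧ (size T ≡ᵇ n)

-- Since the fibres are cliques, an independent set meets each fibre at most once,
-- so the independent sets of size n are exactly the independent transversals.
countIndependentOfSize≡countIndependentTransversals : ∀ n m (R : Rel n m) → FibresAreCliques R →
  countSubsets (n * m) (independentOfSize R) ≡ countFun n m (independentTransversal R)
countIndependentOfSize≡countIndependentTransversals zero    m R cliques = refl
countIndependentOfSize≡countIndependentTransversals (suc n) m R cliques = begin
  countSubsets (m + n * m) (independentOfSize R)  ≡⟨ countSubsets-append m (n * m) (independentOfSize R) ⟩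
  sumSubsets m extensions                          ≡⟨ sumSubsets-onlySingletons m extensions-resp twoInHead emptyHead ⟩
  sumFin m (extensions ∘ singleton)                ≡⟨ sumFin-cong m singletonHead ⟩
  countFun (suc n) m (independentTransversal R)    ∎
  where
  open ≡-Reasoning
  extensions : (Fin m → Bool) → ℕ
  extensions S = countSubsets (n * m) λ T → independentOfSize R (append S T)

  extensions-resp : Respects≗ extensions
  extensions-resp S S′ e = countSubsets-cong (n * m) λ T →
    cong₂ _∧_ (independent-resp R _ _ (append-congˡ T e)) (cong (_≡ᵇ suc n) (size-cong (append-congˡ T e)))

  twoInHead : ∀ S i j → i ≢ j → S i ≡ true → S j ≡ true → extensions S ≡ 0
  twoInHead S i j i≢j Si Sj = countSubsets-≡0 (n * m) λ T →
    ∧-falseˡ _ λ h → i≢j (independent-head-AtMostOne R cliques h i j Si Sj)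

  emptyHead : ∀ S → (∀ i → S i ≡ false) → extensions S ≡ 0
  emptyHead S none = countSubsets-≡0 (n * m) λ T → ∧-falseʳ λ h →
    subst (λ z → (z ≡ᵇ suc n) ≡ false)
          (sym (trans (size-append S T) (cong (_+ size T) (sumFin-≡0 m (cong ifb ∘ none)))))
          (≤⇒≡ᵇ-suc-false (independent-size≤ n m (tailRel R) (FibresAreCliques-tail {R = R} cliques) T
                             (proj₂ (proj₂ (proj₂ (independent-append⇒parts R S T h))))))

  guarded : ∀ {a} b → countSubsets (n * m) (λ T → b ∧ independentOfSize (avoidingRel R a) T)
                      ≡ countFun n m (λ c → b ∧ independentTransversal (avoidingRel R a) c)
  guarded         false = trans (countSubsets-≡0 (n * m) λ _ → refl) (sym (countFun-≡0 n m λ _ → refl))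
  guarded {a = a} true  = countIndependentOfSize≡countIndependentTransversals n m (avoidingRel R a)
                            (FibresAreCliques-avoiding R a cliques)

  singletonHead : ∀ a → extensions (singleton a) ≡ countFun n m (independentTransversal R ∘ cons a)
  singletonHead a = begin
    extensions (singleton a)
      ≡⟨ countSubsets-cong (n * m) (λ T →
           trans (cong₂ _∧_ (independent-singleton-append R a T)
                            (cong (_≡ᵇ suc n) (trans (size-append (singleton a) T)
                                                     (cong (_+ size T) (size-singleton a)))))
                 (∧-assoc (headLoopFree R a) _ _)) ⟩
    countSubsets (n * m) (λ T → headLoopFree R a ∧ independentOfSize (avoidingRel R a) T)
      ≡⟨ guarded (headLoopFree R a) ⟩
    countFun n m (λ c → headLoopFree R a ∧ independentTransversal (avoidingRel R a) c)
      ≡⟨ countFun-cong n m (λ c → sym (independentTransversal-cons R a c)) ⟩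
    countFun n m (independentTransversal R ∘ cons a)
      ∎

coverEdge-fibresAreCliques : ∀ {G : Graph} {m} (ℋ : Cover G m) → FibresAreCliques (coverEdge ℋ)
coverEdge-fibresAreCliques ℋ u i j i≢j rewrite eqF-refl u | eqF-≢ i≢j = refl

dpCount≡countColourings : ∀ {G : Graph} {m} (ℋ : Cover G m) →
                          dpCount ℋ ≡ countFun (n G) m (independentTransversal (coverEdge ℋ))
dpCount≡countColourings {G} {m} ℋ =
  countIndependentOfSize≡countIndependentTransversals (n G) m (coverEdge ℋ) (coverEdge-fibresAreCliques ℋ)

clash : (G : Graph) (m : ℕ) → Rel (n G) m
clash G m (u , i) (v , j) = adj G u v ∧ eqF i j

isProper-resp : ∀ (G : Graph) m → Respects≗ (isProper G m)
isProper-resp G m = independentTransversal-resp (clash G m)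

isProper-punchIn : ∀ (G : Graph) m (a : Fin (suc m)) (d : Fin (n G) → Fin m) →
                   isProper G (suc m) (punchIn a ∘ d) ≡ isProper G m d
isProper-punchIn G m a d = allFin-cong (n G) λ u → allFin-cong (n G) λ v →
  cong (λ z → not (adj G u v ∧ z)) (eqF-punchIn a (d u) (d v))

canonicalCover : (G : Graph) (m : ℕ) → Cover G m
canonicalCover G m = record
  { cross          = λ u i v j → clash G m (u , i) (v , j)
  ; cross-sym      = λ u i v j → cong₂ _∧_ (adj-sym G u v) (eqF-sym i j)
  ; cross-adj      = λ u i v j → ∧-elimˡ
  ; cross-matching = λ u i v j j′ h h′ →
      trans (sym (eqF-≡ (∧-elimʳ (adj G u v) h))) (eqF-≡ (∧-elimʳ (adj G u v) h′))
  }

dpCount-canonicalCover : ∀ (G : Graph) m → dpCount (canonicalCover G m) ≡ chromPoly G m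
dpCount-canonicalCover G m =
  trans (dpCount≡countColourings (canonicalCover G m))
        (countFun-cong (n G) m λ c → allFin-cong (n G) λ u → allFin-cong (n G) λ v → cong not (onTransversal c u v))
  where
  onTransversal : ∀ (c : Fin (n G) → Fin m) u v →
                  coverEdge (canonicalCover G m) (u , c u) (v , c v) ≡ clash G m (u , c u) (v , c v)
  onTransversal c u v with eqF u v in u≟v
  ... | false = refl
  ... | true with refl ← eqF-≡ u≟v rewrite eqF-refl (c u) | adj-irrefl G u = refl

DPEqChrom-intro : ∀ (G : Graph) m → (∀ (ℋ : Cover G m) → chromPoly G m ≤ dpCount ℋ) → DPEqChrom G m
DPEqChrom-intro G m lower = (canonicalCover G m , dpCount-canonicalCover G m) , lower

module Cone (G : Graph) (p : ℕ) where

  H H′ : Graph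
  H  = K p ∨G G
  H′ = K (suc p) ∨G G

  k : ℕ
  k = n H

  adj-apex : ∀ v → adj H′ zero (suc v) ≡ true
  adj-apex v with splitAt p v
  ... | inj₁ _ = refl
  ... | inj₂ _ = refl

  adj-suc : ∀ u v → adj H′ (suc u) (suc v) ≡ adj H u v
  adj-suc u v with splitAt p u | splitAt p v
  ... | inj₁ a | inj₁ b = cong not (eqF-suc a b)
  ... | inj₁ _ | inj₂ _ = refl
  ... | inj₂ _ | inj₁ _ = refl
  ... | inj₂ _ | inj₂ _ = refl

  isProper-cone : ∀ s a (c : Fin k → Fin s) → isProper H′ s (cons a c) ≡ avoids a c ∧ isProper H s c
  isProper-cone s a c = true⇔true⇒≡ split join
    where
    split : isProper H′ s (cons a c) ≡ true → avoids a c ∧ isProper H s c ≡ true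
    split h = ∧-intro
      (allFin-intro k λ u → false⇒not-true (trans (eqF-sym (c u) a)
         (subst (λ z → z ∧ eqF a (c u) ≡ false) (adj-apex u) (E zero (suc u)))))
      (independentTransversal-intro (clash H s) λ u v →
         subst (λ z → z ∧ eqF (c u) (c v) ≡ false) (adj-suc u v) (E (suc u) (suc v)))
      where E = independentTransversal-elim (clash H′ s) {cons a c} h
    join : avoids a c ∧ isProper H s c ≡ true → isProper H′ s (cons a c) ≡ true
    join h = independentTransversal-intro (clash H′ s) go
      where
      A = allFin-elim k (∧-elimˡ h)
      E = independentTransversal-elim (clash H s) (∧-elimʳ (avoids a c) h)
      go : ∀ u v → clash H′ s (u , cons a c u) (v , cons a c v) ≡ false
      go zero    zero    rewrite adj-irrefl H′ zero = refl
      go zero    (suc v) rewrite adj-apex v = trans (eqF-sym a (c v)) (not-true⇒false (A v))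
      go (suc u) zero    rewrite adj-sym H′ (suc u) zero | adj-apex u = not-true⇒false (A u)
      go (suc u) (suc v) rewrite adj-suc u v = E u v

  countProper-apexFixed : ∀ m (a : Fin (suc m)) →
                          countFun k (suc m) (isProper H′ (suc m) ∘ cons a) ≡ chromPoly H m
  countProper-apexFixed m a =
    trans (countFun-cong k (suc m) (isProper-cone (suc m) a))
          (trans (countFun-avoiding k m a (isProper-resp H (suc m)))
                 (countFun-cong k m (isProper-punchIn H m a)))

  -- In a fibre containing no neighbour of (zero , a), an arbitrary vertex is removed instead.
  module Restriction (m : ℕ) (ℋ : Cover H′ (suc m)) (a : Fin (suc m)) where

    apexNeighbour : ∀ u → ∃ λ q → ∀ i → cross ℋ zero a (suc u) (punchIn q i) ≡ false
    apexNeighbour u = AtMostOne⇒false-off-punchIn (cross ℋ zero a (suc u)) (cross-matching ℋ zero a (suc u))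

    φ : Fin k → Fin m → Fin (suc m)
    φ u = punchIn (proj₁ (apexNeighbour u))

    φ-injective : ∀ u {i j} → φ u i ≡ φ u j → i ≡ j
    φ-injective u = punchIn-injective (proj₁ (apexNeighbour u)) _ _

    restrictedCover : Cover H m
    restrictedCover = record
      { cross          = λ u i v j → cross ℋ (suc u) (φ u i) (suc v) (φ v j)
      ; cross-sym      = λ u i v j → cross-sym ℋ (suc u) (φ u i) (suc v) (φ v j)
      ; cross-adj      = λ u i v j h → trans (sym (adj-suc u v)) (cross-adj ℋ (suc u) (φ u i) (suc v) (φ v j) h)
      ; cross-matching = λ u i v j j′ h h′ →
          φ-injective v (cross-matching ℋ (suc u) (φ u i) (suc v) (φ v j) (φ v j′) h h′)
      }

    coverEdge-restricted : ∀ u i v j → coverEdge ℋ (suc u , φ u i) (suc v , φ v j)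
                                       ≡ coverEdge restrictedCover (u , i) (v , j)
    coverEdge-restricted u i v j rewrite eqF-suc u v with eqF u v in u≟v
    ... | false = refl
    ... | true with refl ← eqF-≡ u≟v = cong not (eqF-punchIn (proj₁ (apexNeighbour u)) i j)

    lift : ∀ d → independentTransversal (coverEdge restrictedCover) d ≡ true →
           independentTransversal (coverEdge ℋ) (cons a (λ u → φ u (d u))) ≡ true
    lift d h = independentTransversal-intro (coverEdge ℋ) go
      where
      c = cons a (λ u → φ u (d u))
      go : ∀ x y → coverEdge ℋ (x , c x) (y , c y) ≡ false
      go zero    zero    = cong not (eqF-refl a)
      go zero    (suc v) = proj₂ (apexNeighbour v) (d v)
      go (suc u) zero    = trans (cross-sym ℋ (suc u) (φ u (d u)) zero a) (proj₂ (apexNeighbour u) (d u))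
      go (suc u) (suc v) = trans (coverEdge-restricted u (d u) v (d v))
                                 (independentTransversal-elim (coverEdge restrictedCover) h u v)

    countProper≤countColourings : (∀ (ℋ₀ : Cover H m) → chromPoly H m ≤ dpCount ℋ₀) →
      countFun k (suc m) (isProper H′ (suc m) ∘ cons a)
        ≤ countFun k (suc m) (independentTransversal (coverEdge ℋ) ∘ cons a)
    countProper≤countColourings lower = begin
      countFun k (suc m) (isProper H′ (suc m) ∘ cons a)            ≡⟨ countProper-apexFixed m a ⟩
      chromPoly H m                                                ≤⟨ lower restrictedCover ⟩
      dpCount restrictedCover                                      ≡⟨ dpCount≡countColourings restrictedCover ⟩
      countFun k m (independentTransversal (coverEdge restrictedCover))
        ≤⟨ countFun-≤-injective k m (suc m) φ φ-injective
             (λ c c′ e → independentTransversal-resp (coverEdge ℋ) (cons a c) (cons a c′)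
                           λ { zero → refl ; (suc u) → e u })
             lift ⟩
      countFun k (suc m) (independentTransversal (coverEdge ℋ) ∘ cons a) ∎
      where open ≤-Reasoning

  chromPoly≤dpCount-cone : ∀ m → (∀ (ℋ : Cover H m) → chromPoly H m ≤ dpCount ℋ) →
                           ∀ (ℋ : Cover H′ (suc m)) → chromPoly H′ (suc m) ≤ dpCount ℋ
  chromPoly≤dpCount-cone m lower ℋ =
    subst (chromPoly H′ (suc m) ≤_) (sym (dpCount≡countColourings ℋ))
          (sumFin-mono (suc m) λ a → Restriction.countProper≤countColourings m ℋ a lower)

  colourable-cone : ∀ j → Colorable H j → Colorable H′ (suc j)
  colourable-cone j (d , proper) = cons zero (suc ∘ d) ,
    trans (isProper-cone (suc j) zero (suc ∘ d))
          (∧-intro (allFin-intro k λ _ → refl) (trans (isProper-punchIn H j zero d) proper))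

  colourable-uncone : ∀ j → Colorable H′ (suc j) → Colorable H j
  colourable-uncone j (f , proper) = d ,
    trans (sym (isProper-punchIn H j a d))
          (trans (isProper-resp H (suc j) _ _ λ u → punchIn-punchOut (a≢ u)) (∧-elimʳ (avoids a (f ∘ suc)) split))
    where
    a = f zero
    split : avoids a (f ∘ suc) ∧ isProper H (suc j) (f ∘ suc) ≡ true
    split = trans (sym (isProper-cone (suc j) a (f ∘ suc)))
                  (trans (isProper-resp H′ (suc j) (cons a (f ∘ suc)) f λ { zero → refl ; (suc u) → refl }) proper)
    a≢ : ∀ u → a ≢ f (suc u)
    a≢ u = not-eqF⇒≢ (allFin-elim k (∧-elimˡ split) u) ∘ sym
    d : Fin k → Fin j
    d u = punchOut (a≢ u)

  chromaticNumber-uncone : ∀ c → IsChromaticNumber H′ (suc c) → IsChromaticNumber H c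
  chromaticNumber-uncone c (colourable , minimal) =
    colourable-uncone c colourable , λ j j<c colourableH → minimal (suc j) (s≤s j<c) (colourable-cone j colourableH)

theorem1p7 : (G : Graph) (p : ℕ)
    → (∀ N → (∀ m → N ≤ m → DPEqChrom (K p ∨G G) m)
           → ∀ s → suc N ≤ s → DPEqChrom (K (suc p) ∨G G) s)
      × (∀ t t' → IsDPThreshold (K p ∨G G) t → IsDPThreshold (K (suc p) ∨G G) t' → t' ≤ suc t)
theorem1p7 G p = DPEq-step , threshold-step
  where
  open Cone G p
  DPEq-step : ∀ N → (∀ m → N ≤ m → DPEqChrom H m) → ∀ s → suc N ≤ s → DPEqChrom H′ s
  DPEq-step N DPEq (suc m) (s≤s N≤m) =
    DPEqChrom-intro H′ (suc m) (chromPoly≤dpCount-cone m (proj₂ (DPEq m N≤m)))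

  threshold-step : ∀ t t′ → IsDPThreshold H t → IsDPThreshold H′ t′ → t′ ≤ suc t
  threshold-step t t′ ((χ≤t , DPEq) , _) (_ , least) = least (suc t) (χ′≤1+t , DPEq-step t DPEq)
    where
    χ′≤1+t : ∀ χ → IsChromaticNumber H′ χ → χ ≤ suc t
    χ′≤1+t zero    _    = z≤n
    χ′≤1+t (suc c) isχ′ = s≤s (χ≤t c (chromaticNumber-uncone c isχ′))
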